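{- Let $h,d\ge 1$ be integers. Draw coupons independently and uniformly at random (with replacement) from $d$ types, and let $T$ be the first draw at which at least $h$ copies of each of the $d$ types have been obtained. Then for every integer $n\ge 0$, \[\Pr(T=n)=\frac{d!}{d^n}\binom{n-1}{h-1}\left\{ {n-h \atop d-1} \right\}_{\ge h},\] where $\left\{ {m \atop k} \right\}_{\ge h}$ denotes the number of partitions of an $m$-element set into $k$ (unordered) blocks each of size at least $h$ (with the value $1$ for $m=k=0$ and $0$ when $m<0$).
   Context: Binomial coefficients $\binom{n-1}{h-1}$ with $n-1<h-1$ are taken to be $0$ (for $n\ge 1$); the formula is meant with the convention that all terms vanish when $n<h$. -}

module Defs where

open import Data.Nat using (ℕ; zero; suc; _≤ᵇ_; _≡ᵇ_; _<ᵇ_)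
open import Data.Bool using (Bool; true; false; _∧_; not; if_then_else_)
open import Data.Fin using (Fin; toℕ)
open import Data.Fin.Properties using (_≟_)
open import Data.List using (List; []; _∷_; map; concatMap; take; allFin; upTo)
open import Relation.Nullary.Decidable using (does)
open import Relation.Binary.PropositionalEquality using (_≡_)

all : {A : Set} → (A → Bool) → List A → Bool
all p []       = true
all p (x ∷ xs) = p x ∧ all p xs

countᵇ : {A : Set} → (A → Bool) → List A → ℕ
countᵇ p []       = zero
countᵇ p (x ∷ xs) = if p x then suc (countᵇ p xs) else countᵇ p xs

-- All lists of length n with entries in Fin d (= all outcomes of n draws
-- from d coupon types); there are exactly d^n of them, each equally likely.
seqs : (d n : ℕ) → List (List (Fin d))
seqs d zero    = [] ∷ []
seqs d (suc n) = concatMap (λ x → map (x ∷_) (seqs d n)) (allFin d)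

occ : {d : ℕ} → Fin d → List (Fin d) → ℕ
occ i []       = zero
occ i (x ∷ xs) = if does (i ≟ x) then suc (occ i xs) else occ i xs

complete : (h d : ℕ) → List (Fin d) → Bool
complete h d s = all (λ i → h ≤ᵇ occ i s) (allFin d)

hitsAt : (h d n : ℕ) → List (Fin d) → Bool
hitsAt h d n s = complete h d (take n s) ∧ all (λ k → not (complete h d (take k s))) (upTo n)

-- number of length-n draw sequences with T = n  (so Pr(T = n) = this / d^n)
countT : (h d n : ℕ) → ℕ
countT h d n = countᵇ (hitsAt h d n) (seqs d n)

-- Set partitions of {0,…,m-1} into k unordered blocks are encoded canonically
-- as restricted growth strings: labelings f : Fin m → Fin k (a list of length m)
-- in which block labels appear for the first time in increasing order 0,1,2,…
-- (block j is labelled by the rank of its least element).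
-- rgs c xs : every entry is ≤ c, where c = number of labels seen so far.
rgs : {k : ℕ} → ℕ → List (Fin k) → Bool
rgs c []       = true
rgs c (x ∷ xs) = (toℕ x ≤ᵇ c) ∧ rgs (if toℕ x ≡ᵇ c then suc c else c) xs

isPartition≥ : (h m k : ℕ) → List (Fin k) → Bool
isPartition≥ h m k f = rgs 0 f ∧ all (λ i → h ≤ᵇ occ i f) (allFin k)

-- { m \atop k }_{≥ h} : number of partitions of an m-set into k blocks each of
-- size ≥ h (for h ≥ 1 the value at m = k = 0 is 1).
S≥ : (h m k : ℕ) → ℕ
S≥ h m k = countᵇ (isPartition≥ h m k) (seqs k m)

-- Condition on the last draw x.  T = n exactly when the first n − 1 draws contain x exactly h − 1
-- times and, with x deleted, every other type at least h times.  Choosing the positions of x gives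
-- d · C(n − 1, h − 1) · W(d − 1, n − h), where W(k, m) counts the words of length m over k letters
-- using every letter at least h times.  Splitting off the first position (with all occurrences of its
-- letter, resp. with its block) gives W(k + 1, m + 1) = (k + 1) · Σⱼ C(m, j) [j + 1 ≥ h] W(k, m − j)
-- and the same recurrence without the factor k + 1 for S≥(m, k); hence W(k, m) = k! · S≥(m, k).
{-# OPTIONS --safe #-}
module Submission where

open import Defs
open import Data.Nat using (ℕ; _*_; _∸_; _≤ᵇ_; _≥_; _!)
open import Data.Nat.Combinatorics using (_C_)
open import Data.Bool using (if_then_else_)
open import Relation.Binary.PropositionalEquality using (_≡_)

open import Data.Nat using (zero; suc; _+_; _≤_; _<ᵇ_; _≡ᵇ_; z≤n; s≤s)
open import Data.Nat.Properties
  using (≤-refl; ≤-reflexive; ≤-trans; ≤ᵇ⇒≤; ≤⇒≤ᵇ; n<1+n; +-identityʳ; +-assoc; +-comm; *-assoc;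
         *-identityˡ; *-zeroʳ; *-distribʳ-+; +-∸-assoc; +-*-semiring; +-commutativeSemigroup;
         *-commutativeSemigroup)
open import Data.Nat.Combinatorics using (nCk+nC[k+1]≡[n+1]C[k+1]; k>n⇒nCk≡0)
open import Data.Nat.Solver using (module +-*-Solver)
open import Data.Bool using (Bool; true; false; _∧_; not; T)
open import Data.Fin using (Fin; zero; suc; toℕ; punchIn; punchOut)
open import Data.Fin.Properties
  using (_≟_; toℕ≤pred[n]; toℕ-inject₁; toℕ-fromℕ; punchInᵢ≢i; punchOut-cong; punchOut-punchIn;
         punchIn-punchOut)
open import Data.List using (List; []; _∷_; _++_; map; concatMap; tabulate; allFin; length; take; upTo)
open import Data.List.Properties using (++-identityʳ; length-++; upTo-∷ʳ; take-all)
open import Relation.Nullary using (yes; no; contradiction)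
open import Relation.Nullary.Decidable using (does; dec-true; dec-false)
open import Function using (_∘_; Equivalence)
open import Data.Product using (_,_)
open import Data.Empty using (⊥-elim)
open import Relation.Binary.PropositionalEquality using (refl; sym; trans; cong; cong₂; module ≡-Reasoning)
open import Algebra.Properties.Semiring.Sum +-*-semiring
  using (sum-syntax; sum⁺-syntax; sum-cong-≗; sum-remove; sum-init-last; sum-replicate-zero;
         ∑-distrib-+; ∑-comm; *-distribˡ-sum)

open import Algebra.Bundles using (CommutativeMonoid)
open import Data.Bool.Properties using (∧-commutativeMonoid; ∧-assoc; ∧-identityʳ; ∧-inverseʳ; T-∧)
import Algebra.Properties.CommutativeSemigroup as CommSemigroupProperties
open CommSemigroupProperties (CommutativeMonoid.commutativeSemigroup ∧-commutativeMonoid)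
  using () renaming (x∙yz≈y∙xz to ∧-swap)
open CommSemigroupProperties *-commutativeSemigroup
  using () renaming (x∙yz≈y∙xz to *-swap)
open CommSemigroupProperties +-commutativeSemigroup
  using () renaming (x∙yz≈y∙xz to +-swap)

open ≡-Reasoning

𝟙 : Bool → ℕ
𝟙 true  = 1
𝟙 false = 0

𝟙-∧ : ∀ a b → 𝟙 (a ∧ b) ≡ 𝟙 a * 𝟙 b
𝟙-∧ true  b = sym (+-identityʳ (𝟙 b))
𝟙-∧ false b = refl

∑-const : ∀ n c → ∑[ i < n ] c ≡ n * c
∑-const zero    c = refl
∑-const (suc n) c = cong (c +_) (∑-const n c)

∑-sift : ∀ n a (f : ℕ → ℕ) → ∑[ j < n ] (𝟙 (a ≡ᵇ toℕ j) * f (toℕ j)) ≡ 𝟙 (a <ᵇ n) * f a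
∑-sift zero    a       f = refl
∑-sift (suc n) zero    f = trans (cong (f 0 + 0 +_) (sum-replicate-zero n)) (+-identityʳ _)
∑-sift (suc n) (suc a) f = ∑-sift n a (f ∘ suc)

∑-toℕ-last : ∀ n (f : ℕ → ℕ) → ∑[ j ≤ n ] f (toℕ j) ≡ ∑[ j < n ] f (toℕ j) + f n
∑-toℕ-last n f = trans (sum-init-last {n} (f ∘ toℕ))
  (cong₂ _+_ (sum-cong-≗ {n} (cong f ∘ toℕ-inject₁)) (cong f (toℕ-fromℕ n)))

binomialSum : ℕ → (ℕ → ℕ) → ℕ
binomialSum m G = ∑[ j ≤ m ] ((m C toℕ j) * G (toℕ j))

binomialSum-cong : ∀ m {G H : ℕ → ℕ} → (∀ j → j ≤ m → G j ≡ H j) →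
  binomialSum m G ≡ binomialSum m H
binomialSum-cong m G≡H =
  sum-cong-≗ {suc m} (λ j → cong ((m C toℕ j) *_) (G≡H (toℕ j) (toℕ≤pred[n] j)))

binomialSum-* : ∀ m c (G : ℕ → ℕ) → binomialSum m (λ j → c * G j) ≡ c * binomialSum m G
binomialSum-* m c G = begin
  ∑[ j ≤ m ] ((m C toℕ j) * (c * G (toℕ j)))
    ≡⟨ sum-cong-≗ {suc m} (λ j → *-swap (m C toℕ j) c (G (toℕ j))) ⟩
  ∑[ j ≤ m ] (c * ((m C toℕ j) * G (toℕ j)))
    ≡⟨ *-distribˡ-sum {suc m} c (λ j → (m C toℕ j) * G (toℕ j)) ⟨
  c * binomialSum m G
    ∎

binomialSum-∑ : ∀ m d (G : Fin d → ℕ → ℕ) →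
  ∑[ i < d ] binomialSum m (G i) ≡ binomialSum m (λ j → ∑[ i < d ] G i j)
binomialSum-∑ m d G = begin
  ∑[ i < d ] ∑[ j ≤ m ] ((m C toℕ j) * G i (toℕ j))
    ≡⟨ ∑-comm {d} {suc m} (λ i j → (m C toℕ j) * G i (toℕ j)) ⟩
  ∑[ j ≤ m ] ∑[ i < d ] ((m C toℕ j) * G i (toℕ j))
    ≡⟨ sum-cong-≗ {suc m} (λ j → *-distribˡ-sum {d} (m C toℕ j) (λ i → G i (toℕ j))) ⟨
  binomialSum m (λ j → ∑[ i < d ] G i j)
    ∎

binomialSum-suc : ∀ m (G : ℕ → ℕ) →
  binomialSum (suc m) G ≡ binomialSum m (G ∘ suc) + binomialSum m G
binomialSum-suc m G = begin
  binomialSum (suc m) G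
    ≡⟨⟩
  1 * G 0 + ∑[ j ≤ m ] ((suc m C suc (toℕ j)) * G (suc (toℕ j)))
    ≡⟨ cong (1 * G 0 +_) (sum-cong-≗ {suc m} (λ j → pascal (toℕ j))) ⟩
  1 * G 0 + ∑[ j ≤ m ] ((m C toℕ j) * G (suc (toℕ j)) + upper (toℕ j))
    ≡⟨ cong (1 * G 0 +_) (∑-distrib-+ {suc m} (λ j → (m C toℕ j) * G (suc (toℕ j))) (upper ∘ toℕ)) ⟩
  1 * G 0 + (binomialSum m (G ∘ suc) + ∑[ j ≤ m ] upper (toℕ j))
    ≡⟨ cong (λ t → 1 * G 0 + (binomialSum m (G ∘ suc) + t)) top-term-vanishes ⟩
  1 * G 0 + (binomialSum m (G ∘ suc) + ∑[ j < m ] upper (toℕ j))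
    ≡⟨ +-swap (1 * G 0) (binomialSum m (G ∘ suc)) _ ⟩
  binomialSum m (G ∘ suc) + binomialSum m G
    ∎
  where
  upper : ℕ → ℕ
  upper j = (m C suc j) * G (suc j)
  pascal : ∀ j → (suc m C suc j) * G (suc j) ≡ (m C j) * G (suc j) + upper j
  pascal j = trans (cong (_* G (suc j)) (sym (nCk+nC[k+1]≡[n+1]C[k+1] m j)))
                   (*-distribʳ-+ (G (suc j)) (m C j) (m C suc j))
  top-term-vanishes : ∑[ j ≤ m ] upper (toℕ j) ≡ ∑[ j < m ] upper (toℕ j)
  top-term-vanishes = begin
    ∑[ j ≤ m ] upper (toℕ j)
      ≡⟨ ∑-toℕ-last m upper ⟩
    ∑[ j < m ] upper (toℕ j) + (m C suc m) * G (suc m)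
      ≡⟨ cong (λ c → ∑[ j < m ] upper (toℕ j) + c * G (suc m)) (k>n⇒nCk≡0 (n<1+n m)) ⟩
    ∑[ j < m ] upper (toℕ j) + 0
      ≡⟨ +-identityʳ _ ⟩
    ∑[ j < m ] upper (toℕ j)
      ∎

binomialSum-point : ∀ m a (G : ℕ → ℕ) →
  binomialSum m (λ j → 𝟙 (a ≡ᵇ j) * G j) ≡ 𝟙 (a <ᵇ suc m) * ((m C a) * G a)
binomialSum-point m a G = trans
  (sum-cong-≗ {suc m} (λ j → *-swap (m C toℕ j) (𝟙 (a ≡ᵇ toℕ j)) (G (toℕ j))))
  (∑-sift (suc m) a (λ j → (m C j) * G j))

Σ-words : (d n : ℕ) → (List (Fin d) → ℕ) → ℕ
Σ-words d zero    f = f []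
Σ-words d (suc n) f = ∑[ x < d ] Σ-words d n (f ∘ (x ∷_))

countᵇ-∷ : ∀ {A : Set} (p : A → Bool) x xs → countᵇ p (x ∷ xs) ≡ 𝟙 (p x) + countᵇ p xs
countᵇ-∷ p x xs with p x
... | true  = refl
... | false = refl

countᵇ-++ : ∀ {A : Set} (p : A → Bool) xs ys → countᵇ p (xs ++ ys) ≡ countᵇ p xs + countᵇ p ys
countᵇ-++ p []       ys = refl
countᵇ-++ p (x ∷ xs) ys = begin
  countᵇ p (x ∷ xs ++ ys)               ≡⟨ countᵇ-∷ p x (xs ++ ys) ⟩
  𝟙 (p x) + countᵇ p (xs ++ ys)         ≡⟨ cong (𝟙 (p x) +_) (countᵇ-++ p xs ys) ⟩
  𝟙 (p x) + (countᵇ p xs + countᵇ p ys) ≡⟨ +-assoc (𝟙 (p x)) _ _ ⟨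
  (𝟙 (p x) + countᵇ p xs) + countᵇ p ys ≡⟨ cong (_+ countᵇ p ys) (countᵇ-∷ p x xs) ⟨
  countᵇ p (x ∷ xs) + countᵇ p ys       ∎

countᵇ-map : ∀ {A B : Set} (p : B → Bool) (f : A → B) xs → countᵇ p (map f xs) ≡ countᵇ (p ∘ f) xs
countᵇ-map p f []       = refl
countᵇ-map p f (x ∷ xs) with p (f x)
... | true  = cong suc (countᵇ-map p f xs)
... | false = countᵇ-map p f xs

countᵇ-concatMap-tabulate : ∀ {A B : Set} (p : A → Bool) (g : B → List A) n (t : Fin n → B) →
  countᵇ p (concatMap g (tabulate t)) ≡ ∑[ i < n ] countᵇ p (g (t i))
countᵇ-concatMap-tabulate p g zero    t = refl
countᵇ-concatMap-tabulate p g (suc n) t =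
  trans (countᵇ-++ p (g (t zero)) _)
        (cong (countᵇ p (g (t zero)) +_) (countᵇ-concatMap-tabulate p g n (t ∘ suc)))

countᵇ-seqs : (d n : ℕ) (p : List (Fin d) → Bool) → countᵇ p (seqs d n) ≡ Σ-words d n (𝟙 ∘ p)
countᵇ-seqs d zero    p = trans (countᵇ-∷ p [] []) (+-identityʳ _)
countᵇ-seqs d (suc n) p = begin
  countᵇ p (concatMap (λ x → map (x ∷_) (seqs d n)) (allFin d))
    ≡⟨ countᵇ-concatMap-tabulate p (λ x → map (x ∷_) (seqs d n)) d (λ x → x) ⟩
  ∑[ x < d ] countᵇ p (map (x ∷_) (seqs d n))
    ≡⟨ sum-cong-≗ {d} (λ x → trans (countᵇ-map p (x ∷_) (seqs d n)) (countᵇ-seqs d n (p ∘ (x ∷_)))) ⟩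
  Σ-words d (suc n) (𝟙 ∘ p)
    ∎

Σ-words-cong : (d n : ℕ) {f g : List (Fin d) → ℕ} → (∀ u → length u ≡ n → f u ≡ g u) →
  Σ-words d n f ≡ Σ-words d n g
Σ-words-cong d zero    f≡g = f≡g [] refl
Σ-words-cong d (suc n) f≡g =
  sum-cong-≗ {d} (λ x → Σ-words-cong d n (λ u ∣u∣≡n → f≡g (x ∷ u) (cong suc ∣u∣≡n)))

Σ-words-* : (d n c : ℕ) (f : List (Fin d) → ℕ) → Σ-words d n (λ u → c * f u) ≡ c * Σ-words d n f
Σ-words-* d zero    c f = refl
Σ-words-* d (suc n) c f =
  trans (sum-cong-≗ {d} (λ x → Σ-words-* d n c (f ∘ (x ∷_))))
        (sym (*-distribˡ-sum {d} c (λ x → Σ-words d n (f ∘ (x ∷_)))))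

Σ-words-zero : (d n : ℕ) → Σ-words d n (λ _ → 0) ≡ 0
Σ-words-zero d zero    = refl
Σ-words-zero d (suc n) = trans (sum-cong-≗ {d} (λ _ → Σ-words-zero d n)) (sum-replicate-zero d)

Σ-words-snoc : (d n : ℕ) (f : List (Fin d) → ℕ) →
  Σ-words d (suc n) f ≡ ∑[ x < d ] Σ-words d n (λ u → f (u ++ x ∷ []))
Σ-words-snoc d zero    f = refl
Σ-words-snoc d (suc n) f =
  trans (sum-cong-≗ {d} (λ y → Σ-words-snoc d n (f ∘ (y ∷_))))
        (∑-comm {d} {d} (λ y x → Σ-words d n (λ u → f (y ∷ u ++ x ∷ []))))

-- Deleting a letter

remove : ∀ {d} → Fin (suc d) → List (Fin (suc d)) → List (Fin d)
remove x []       = []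
remove x (y ∷ ys) with x ≟ y
... | yes _   = remove x ys
... | no x≢y  = punchOut x≢y ∷ remove x ys

remove-self : ∀ {d} (x : Fin (suc d)) u → remove x (x ∷ u) ≡ remove x u
remove-self x u with x ≟ x
... | yes _   = refl
... | no x≢x  = contradiction refl x≢x

remove-punchIn : ∀ {d} (x : Fin (suc d)) i u → remove x (punchIn x i ∷ u) ≡ i ∷ remove x u
remove-punchIn x i u with x ≟ punchIn x i
... | yes x≡xᵢ = contradiction (sym x≡xᵢ) (punchInᵢ≢i x i)
... | no _     = cong (_∷ remove x u) (trans (punchOut-cong x refl) (punchOut-punchIn x))

remove-++ : ∀ {d} (x : Fin (suc d)) u v → remove x (u ++ v) ≡ remove x u ++ remove x v
remove-++ x []      v = refl
remove-++ x (y ∷ u) v with x ≟ y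
... | yes _ = remove-++ x u v
... | no _  = cong (_ ∷_) (remove-++ x u v)

occ-self : ∀ {d} (x : Fin d) u → occ x (x ∷ u) ≡ suc (occ x u)
occ-self x u rewrite dec-true (x ≟ x) refl = refl

occ-punchIn-∷ : ∀ {d} (x : Fin (suc d)) i u → occ x (punchIn x i ∷ u) ≡ occ x u
occ-punchIn-∷ x i u rewrite dec-false (x ≟ punchIn x i) (punchInᵢ≢i x i ∘ sym) = refl

occ-punchIn-remove : ∀ {d} (x : Fin (suc d)) i u → occ (punchIn x i) u ≡ occ i (remove x u)
occ-punchIn-remove x i []      = refl
occ-punchIn-remove x i (y ∷ u) with x ≟ y
... | yes refl rewrite dec-false (punchIn x i ≟ x) (punchInᵢ≢i x i) = occ-punchIn-remove x i u
... | no x≢y with punchIn x i ≟ y | i ≟ punchOut x≢y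
...   | yes _    | yes _    = cong suc (occ-punchIn-remove x i u)
...   | no _     | no _     = occ-punchIn-remove x i u
...   | yes xᵢ≡y | no i≢y′  = contradiction (trans (sym (punchOut-punchIn x)) (punchOut-cong x xᵢ≡y)) i≢y′
...   | no xᵢ≢y  | yes i≡y′ = contradiction (trans (cong (punchIn x) i≡y′) (punchIn-punchOut x≢y)) xᵢ≢y

occ-++ : ∀ {d} (i : Fin d) u v → occ i (u ++ v) ≡ occ i u + occ i v
occ-++ i []      v = refl
occ-++ i (y ∷ u) v with does (i ≟ y)
... | true  = cong suc (occ-++ i u v)
... | false = occ-++ i u v

occ-snoc-self : ∀ {d} (x : Fin d) u → occ x (u ++ x ∷ []) ≡ suc (occ x u)
occ-snoc-self x u = trans (occ-++ x u (x ∷ [])) (trans (cong (occ x u +_) (occ-self x [])) (+-comm (occ x u) 1))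

remove-snoc-self : ∀ {d} (x : Fin (suc d)) u → remove x (u ++ x ∷ []) ≡ remove x u
remove-snoc-self x u =
  trans (remove-++ x u (x ∷ [])) (trans (cong (remove x u ++_) (remove-self x [])) (++-identityʳ (remove x u)))

occ-take-suc : ∀ {d} (i : Fin d) n w → occ i (take n w) ≤ occ i (take (suc n) w)
occ-take-suc i zero    w       = z≤n
occ-take-suc i (suc n) []      = ≤-refl
occ-take-suc i (suc n) (y ∷ w) with does (i ≟ y)
... | true  = s≤s (occ-take-suc i n w)
... | false = occ-take-suc i n w

-- A word over d + 1 letters is the set of positions of x together with a word over the other d.
Σ-words-occ-remove : ∀ {d} (x : Fin (suc d)) (F : ℕ → List (Fin d) → ℕ) (m : ℕ) →
  Σ-words (suc d) m (λ u → F (occ x u) (remove x u)) ≡ binomialSum m (λ j → Σ-words d (m ∸ j) (F j))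
Σ-words-occ-remove x F zero    = sym (trans (+-identityʳ _) (*-identityˡ _))
Σ-words-occ-remove {d} x F (suc m) = begin
  ∑[ y < suc d ] Σ-words (suc d) m (λ u → F (occ x (y ∷ u)) (remove x (y ∷ u)))
    ≡⟨ sum-remove {d} {x} (λ y → Σ-words (suc d) m (λ u → F (occ x (y ∷ u)) (remove x (y ∷ u)))) ⟩
  Σ-words (suc d) m (λ u → F (occ x (x ∷ u)) (remove x (x ∷ u)))
    + ∑[ i < d ] Σ-words (suc d) m (λ u → F (occ x (punchIn x i ∷ u)) (remove x (punchIn x i ∷ u)))
    ≡⟨ cong₂ _+_ (Σ-words-cong (suc d) m (λ u _ → cong₂ F (occ-self x u) (remove-self x u)))
                 (sum-cong-≗ {d} (λ i → Σ-words-cong (suc d) m (λ u _ →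
                    cong₂ F (occ-punchIn-∷ x i u) (remove-punchIn x i u)))) ⟩
  Σ-words (suc d) m (λ u → F (suc (occ x u)) (remove x u))
    + ∑[ i < d ] Σ-words (suc d) m (λ u → F (occ x u) (i ∷ remove x u))
    ≡⟨ cong₂ _+_ (Σ-words-occ-remove x (F ∘ suc) m)
                 (sum-cong-≗ {d} (λ i → Σ-words-occ-remove x (λ j v → F j (i ∷ v)) m)) ⟩
  binomialSum m (G ∘ suc) + ∑[ i < d ] binomialSum m (λ j → Σ-words d (m ∸ j) (λ v → F j (i ∷ v)))
    ≡⟨ cong (binomialSum m (G ∘ suc) +_)
            (binomialSum-∑ m d (λ i j → Σ-words d (m ∸ j) (λ v → F j (i ∷ v)))) ⟩
  binomialSum m (G ∘ suc) + binomialSum m (λ j → Σ-words d (suc (m ∸ j)) (F j))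
    ≡⟨ cong (binomialSum m (G ∘ suc) +_)
            (binomialSum-cong m (λ j j≤m → cong (λ k → Σ-words d k (F j)) (sym (+-∸-assoc 1 j≤m)))) ⟩
  binomialSum m (G ∘ suc) + binomialSum m G
    ≡⟨ binomialSum-suc m G ⟨
  binomialSum (suc m) G
    ∎
  where
  G : ℕ → ℕ
  G j = Σ-words d (suc m ∸ j) (F j)

Σ-words-occ-remove-* : ∀ {d} (x : Fin (suc d)) (a : ℕ → ℕ) (g : List (Fin d) → ℕ) (m : ℕ) →
  Σ-words (suc d) m (λ u → a (occ x u) * g (remove x u)) ≡ binomialSum m (λ j → a j * Σ-words d (m ∸ j) g)
Σ-words-occ-remove-* x a g m = trans (Σ-words-occ-remove x (λ j v → a j * g v) m)
  (binomialSum-cong m (λ j _ → Σ-words-* _ (m ∸ j) (a j) g))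

all-cong : ∀ {A : Set} {p q : A → Bool} → (∀ x → p x ≡ q x) → ∀ xs → all p xs ≡ all q xs
all-cong p≡q []       = refl
all-cong p≡q (x ∷ xs) = cong₂ _∧_ (p≡q x) (all-cong p≡q xs)

all-tabulate : ∀ {A : Set} (p : A → Bool) n (f : Fin n → A) → all p (tabulate f) ≡ all (p ∘ f) (allFin n)
all-tabulate p zero    f = refl
all-tabulate p (suc n) f = cong (p (f zero) ∧_)
  (trans (all-tabulate p n (f ∘ suc)) (sym (all-tabulate (p ∘ f) n suc)))

all-allFin-punchIn : ∀ {d} (x : Fin (suc d)) (p : Fin (suc d) → Bool) →
  all p (allFin (suc d)) ≡ p x ∧ all (p ∘ punchIn x) (allFin d)
all-allFin-punchIn {d}     zero    p = cong (p zero ∧_) (all-tabulate p d suc)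
all-allFin-punchIn {suc d} (suc y) p = begin
  p zero ∧ all p (tabulate suc)
    ≡⟨ cong (p zero ∧_) (trans (all-tabulate p (suc d) suc) (all-allFin-punchIn y (p ∘ suc))) ⟩
  p zero ∧ (p (suc y) ∧ all (p ∘ suc ∘ punchIn y) (allFin d))
    ≡⟨ ∧-swap (p zero) (p (suc y)) _ ⟩
  p (suc y) ∧ (p zero ∧ all (p ∘ suc ∘ punchIn y) (allFin d))
    ≡⟨ cong (λ b → p (suc y) ∧ (p zero ∧ b)) (all-tabulate (p ∘ punchIn (suc y)) d suc) ⟨
  p (suc y) ∧ all (p ∘ punchIn (suc y)) (allFin (suc d))
    ∎

all-mono : ∀ {A : Set} {p q : A → Bool} → (∀ x → T (p x) → T (q x)) → ∀ xs → T (all p xs) → T (all q xs)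
all-mono p⇒q []       _     = _
all-mono p⇒q (x ∷ xs) p[x∷xs] with Equivalence.to T-∧ p[x∷xs]
... | px , pxs = Equivalence.from T-∧ (p⇒q x px , all-mono p⇒q xs pxs)

complete-split : ∀ h {d} (x : Fin (suc d)) u →
  complete h (suc d) u ≡ (h ≤ᵇ occ x u) ∧ complete h d (remove x u)
complete-split h x u = trans (all-allFin-punchIn x (λ i → h ≤ᵇ occ i u))
  (cong ((h ≤ᵇ occ x u) ∧_) (all-cong (λ i → cong (h ≤ᵇ_) (occ-punchIn-remove x i u)) (allFin _)))

complete-∷ : ∀ h {d} (x : Fin (suc d)) u →
  complete h (suc d) (x ∷ u) ≡ (h ≤ᵇ suc (occ x u)) ∧ complete h d (remove x u)
complete-∷ h x u = trans (complete-split h x (x ∷ u))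
  (cong₂ (λ k v → (h ≤ᵇ k) ∧ complete h _ v) (occ-self x u) (remove-self x u))

complete-snoc : ∀ h {d} (x : Fin (suc d)) u →
  complete h (suc d) (u ++ x ∷ []) ≡ (h ≤ᵇ suc (occ x u)) ∧ complete h d (remove x u)
complete-snoc h x u = trans (complete-split h x (u ++ x ∷ []))
  (cong₂ (λ k v → (h ≤ᵇ k) ∧ complete h _ v) (occ-snoc-self x u) (remove-snoc-self x u))

complete-mono : ∀ h d {u v : List (Fin d)} → (∀ i → occ i u ≤ occ i v) →
  T (complete h d u) → T (complete h d v)
complete-mono h d u≤v = all-mono
  (λ i h≤u → ≤⇒≤ᵇ (≤-trans (≤ᵇ⇒≤ h _ h≤u) (u≤v i))) (allFin d)

-- Words using every letter at least h times versus partitions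

<ᵇ-suc : ∀ k c → (k <ᵇ suc c) ≡ (k ≤ᵇ c)
<ᵇ-suc zero    c = refl
<ᵇ-suc (suc k) c = refl

rgs-remove-zero : ∀ {k} c (u : List (Fin (suc k))) → rgs (suc c) u ≡ rgs c (remove zero u)
rgs-remove-zero c []          = refl
rgs-remove-zero c (zero  ∷ u) = rgs-remove-zero c u
rgs-remove-zero c (suc y ∷ u) with toℕ y ≡ᵇ c
... | true  = cong₂ _∧_ (<ᵇ-suc (toℕ y) c) (rgs-remove-zero (suc c) u)
... | false = cong₂ _∧_ (<ᵇ-suc (toℕ y) c) (rgs-remove-zero c u)

-- isPartition≥ ignores its length argument, so m and t are arbitrary.
isPartition≥-zero∷ : ∀ h m t {k} (u : List (Fin (suc k))) →
  isPartition≥ h m (suc k) (zero ∷ u) ≡ (h ≤ᵇ suc (occ zero u)) ∧ isPartition≥ h t k (remove zero u)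
isPartition≥-zero∷ h m t u = trans
  (cong₂ _∧_ (rgs-remove-zero 0 u) (complete-∷ h zero u))
  (∧-swap (rgs 0 (remove zero u)) (h ≤ᵇ suc (occ zero u)) (complete h _ (remove zero u)))

#complete : (h k m : ℕ) → ℕ
#complete h k m = Σ-words k m (𝟙 ∘ complete h k)

#partitions : (h k m : ℕ) → ℕ
#partitions h k m = Σ-words k m (𝟙 ∘ isPartition≥ h m k)

-- Choose the j other members of the block of the first element (or letter).
blockSum : (h m : ℕ) → (ℕ → ℕ) → ℕ
blockSum h m X = binomialSum m (λ j → 𝟙 (h ≤ᵇ suc j) * X (m ∸ j))

blockSum-* : ∀ h m c (X : ℕ → ℕ) → blockSum h m (λ t → c * X t) ≡ c * blockSum h m X
blockSum-* h m c X = trans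
  (binomialSum-cong m (λ j _ → *-swap (𝟙 (h ≤ᵇ suc j)) c (X (m ∸ j))))
  (binomialSum-* m c (λ j → 𝟙 (h ≤ᵇ suc j) * X (m ∸ j)))

#complete-suc : ∀ h k m → #complete h (suc k) (suc m) ≡ suc k * blockSum h m (#complete h k)
#complete-suc h k m = begin
  #complete h (suc k) (suc m)
    ≡⟨⟩
  ∑[ x < suc k ] Σ-words (suc k) m (λ u → 𝟙 (complete h (suc k) (x ∷ u)))
    ≡⟨ sum-cong-≗ {suc k} (λ x → Σ-words-cong (suc k) m (λ u _ →
         trans (cong 𝟙 (complete-∷ h x u)) (𝟙-∧ (h ≤ᵇ suc (occ x u)) (complete h k (remove x u))))) ⟩
  ∑[ x < suc k ] Σ-words (suc k) m (λ u → 𝟙 (h ≤ᵇ suc (occ x u)) * 𝟙 (complete h k (remove x u)))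
    ≡⟨ sum-cong-≗ {suc k} (λ x →
         Σ-words-occ-remove-* x (λ j → 𝟙 (h ≤ᵇ suc j)) (𝟙 ∘ complete h k) m) ⟩
  ∑[ x < suc k ] blockSum h m (#complete h k)
    ≡⟨ ∑-const (suc k) _ ⟩
  suc k * blockSum h m (#complete h k)
    ∎

-- Only labellings starting with 0 are canonical; deleting the 0s leaves a canonical labelling.
#partitions-suc : ∀ h k m → #partitions h (suc k) (suc m) ≡ blockSum h m (#partitions h k)
#partitions-suc h k m = begin
  #partitions h (suc k) (suc m)
    ≡⟨⟩
  Σ-words (suc k) m (λ u → 𝟙 (isPartition≥ h (suc m) (suc k) (zero ∷ u)))
    + ∑[ y < k ] Σ-words (suc k) m (λ _ → 0)
    ≡⟨ cong₂ _+_ (Σ-words-cong (suc k) m (λ u _ →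
           trans (cong 𝟙 (isPartition≥-zero∷ h (suc m) (length u) u))
                 (𝟙-∧ (h ≤ᵇ suc (occ zero u)) (isPartition≥ h (length u) k (remove zero u)))))
         (trans (sum-cong-≗ {k} (λ _ → Σ-words-zero (suc k) m)) (sum-replicate-zero k)) ⟩
  Σ-words (suc k) m (λ u → 𝟙 (h ≤ᵇ suc (occ zero u)) * 𝟙 (isPartition≥ h (length u) k (remove zero u))) + 0
    ≡⟨ +-identityʳ _ ⟩
  Σ-words (suc k) m (λ u → 𝟙 (h ≤ᵇ suc (occ zero u)) * 𝟙 (isPartition≥ h (length u) k (remove zero u)))
    ≡⟨ Σ-words-occ-remove-* zero (λ j → 𝟙 (h ≤ᵇ suc j))
                             (λ v → 𝟙 (isPartition≥ h (length v) k v)) m ⟩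
  blockSum h m (#partitions h k)
    ∎

#complete≡!*#partitions : ∀ h k m → #complete (suc h) k m ≡ k ! * #partitions (suc h) k m
#complete≡!*#partitions h zero    zero    = refl
#complete≡!*#partitions h zero    (suc m) = refl
#complete≡!*#partitions h (suc k) zero    = sym (*-zeroʳ (suc k !))
#complete≡!*#partitions h (suc k) (suc m) = begin
  #complete (suc h) (suc k) (suc m)
    ≡⟨ #complete-suc (suc h) k m ⟩
  suc k * blockSum (suc h) m (#complete (suc h) k)
    ≡⟨ cong (suc k *_) (binomialSum-cong m (λ j _ →
         cong (𝟙 (suc h ≤ᵇ suc j) *_) (#complete≡!*#partitions h k (m ∸ j)))) ⟩
  suc k * blockSum (suc h) m (λ t → k ! * #partitions (suc h) k t)
    ≡⟨ cong (suc k *_) (blockSum-* (suc h) m (k !) (#partitions (suc h) k)) ⟩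
  suc k * (k ! * blockSum (suc h) m (#partitions (suc h) k))
    ≡⟨ *-assoc (suc k) (k !) _ ⟨
  suc k ! * blockSum (suc h) m (#partitions (suc h) k)
    ≡⟨ cong (suc k ! *_) (#partitions-suc (suc h) k m) ⟨
  suc k ! * #partitions (suc h) (suc k) (suc m)
    ∎

-- The stopping time

all-++ : ∀ {A : Set} (p : A → Bool) xs ys → all p (xs ++ ys) ≡ all p xs ∧ all p ys
all-++ p []       ys = refl
all-++ p (x ∷ xs) ys = trans (cong (p x ∧_) (all-++ p xs ys)) (sym (∧-assoc (p x) _ _))

not∧not-mono : ∀ {a b} → (T a → T b) → not a ∧ not b ≡ not b
not∧not-mono {true}  {true}  _   = refl
not∧not-mono {true}  {false} a⇒b = ⊥-elim (a⇒b _)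
not∧not-mono {false} {b}     _   = refl

all-not-upTo-mono : (p : ℕ → Bool) → (∀ n → T (p n) → T (p (suc n))) →
  ∀ n → all (not ∘ p) (upTo (suc n)) ≡ not (p n)
all-not-upTo-mono p mono zero    = ∧-identityʳ (not (p 0))
all-not-upTo-mono p mono (suc n) = begin
  all (not ∘ p) (upTo (suc (suc n)))
    ≡⟨ cong (all (not ∘ p)) (upTo-∷ʳ (suc n)) ⟨
  all (not ∘ p) (upTo (suc n) ++ suc n ∷ [])
    ≡⟨ all-++ (not ∘ p) (upTo (suc n)) (suc n ∷ []) ⟩
  all (not ∘ p) (upTo (suc n)) ∧ (not (p (suc n)) ∧ true)
    ≡⟨ cong₂ _∧_ (all-not-upTo-mono p mono n) (∧-identityʳ (not (p (suc n)))) ⟩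
  not (p n) ∧ not (p (suc n))
    ≡⟨ not∧not-mono (mono n) ⟩
  not (p (suc n))
    ∎

hitsAt-suc : ∀ h d n w →
  hitsAt h d (suc n) w ≡ complete h d (take (suc n) w) ∧ not (complete h d (take n w))
hitsAt-suc h d n w = cong (complete h d (take (suc n) w) ∧_)
  (all-not-upTo-mono (λ k → complete h d (take k w))
    (λ k → complete-mono h d {take k w} {take (suc k) w} (λ i → occ-take-suc i k w)) n)

take-length-++ : ∀ {A : Set} (u v : List A) → take (length u) (u ++ v) ≡ u
take-length-++ []      v = refl
take-length-++ (x ∷ u) v = cong (x ∷_) (take-length-++ u v)

m<ᵇ1+n∧¬m<ᵇn≡m≡ᵇn : ∀ m n → (m <ᵇ suc n) ∧ not (m <ᵇ n) ≡ (m ≡ᵇ n)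
m<ᵇ1+n∧¬m<ᵇn≡m≡ᵇn zero    zero    = refl
m<ᵇ1+n∧¬m<ᵇn≡m≡ᵇn zero    (suc n) = refl
m<ᵇ1+n∧¬m<ᵇn≡m≡ᵇn (suc m) zero    = refl
m<ᵇ1+n∧¬m<ᵇn≡m≡ᵇn (suc m) (suc n) = m<ᵇ1+n∧¬m<ᵇn≡m≡ᵇn m n

hitsAt-snoc-complete : ∀ h d u (x : Fin d) →
  hitsAt h d (suc (length u)) (u ++ x ∷ []) ≡ complete h d (u ++ x ∷ []) ∧ not (complete h d u)
hitsAt-snoc-complete h d u x =
  trans (hitsAt-suc h d (length u) (u ++ x ∷ []))
        (cong₂ (λ w v → complete h d w ∧ not (complete h d v)) take-everything (take-length-++ u (x ∷ [])))
  where
  take-everything : take (suc (length u)) (u ++ x ∷ []) ≡ u ++ x ∷ []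
  take-everything = take-all _ (u ++ x ∷ []) (≤-reflexive (trans (length-++ u) (+-comm (length u) 1)))

hitsAt-snoc : ∀ h {d} (x : Fin (suc d)) u →
  hitsAt (suc h) (suc d) (suc (length u)) (u ++ x ∷ []) ≡ (h ≡ᵇ occ x u) ∧ complete (suc h) d (remove x u)
hitsAt-snoc h {d} x u = begin
  hitsAt (suc h) (suc d) (suc (length u)) (u ++ x ∷ [])
    ≡⟨ hitsAt-snoc-complete (suc h) (suc d) u x ⟩
  complete (suc h) (suc d) (u ++ x ∷ []) ∧ not (complete (suc h) (suc d) u)
    ≡⟨ cong₂ (λ a b → a ∧ not b) (complete-snoc (suc h) x u) (complete-split (suc h) x u) ⟩
  ((h <ᵇ suc a) ∧ c) ∧ not ((h <ᵇ a) ∧ c)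
    ≡⟨ ∧-not-∧ (h <ᵇ suc a) (h <ᵇ a) c ⟩
  ((h <ᵇ suc a) ∧ not (h <ᵇ a)) ∧ c
    ≡⟨ cong (_∧ c) (m<ᵇ1+n∧¬m<ᵇn≡m≡ᵇn h a) ⟩
  (h ≡ᵇ a) ∧ c
    ∎
  where
  a = occ x u
  c = complete (suc h) d (remove x u)
  ∧-not-∧ : ∀ p q c → (p ∧ c) ∧ not (q ∧ c) ≡ (p ∧ not q) ∧ c
  ∧-not-∧ false q     c = refl
  ∧-not-∧ true  true  c = ∧-inverseʳ c
  ∧-not-∧ true  false c = ∧-identityʳ c

countT-suc : ∀ h d n →
  countT (suc h) (suc d) (suc n) ≡ suc d * (𝟙 (h <ᵇ suc n) * ((n C h) * #complete (suc h) d (n ∸ h)))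
countT-suc h d n = begin
  countT (suc h) (suc d) (suc n)
    ≡⟨ countᵇ-seqs (suc d) (suc n) (hitsAt (suc h) (suc d) (suc n)) ⟩
  Σ-words (suc d) (suc n) (𝟙 ∘ hitsAt (suc h) (suc d) (suc n))
    ≡⟨ Σ-words-snoc (suc d) n (𝟙 ∘ hitsAt (suc h) (suc d) (suc n)) ⟩
  ∑[ x < suc d ] Σ-words (suc d) n (λ u → 𝟙 (hitsAt (suc h) (suc d) (suc n) (u ++ x ∷ [])))
    ≡⟨ sum-cong-≗ {suc d} (λ x → Σ-words-cong (suc d) n (hitsAt-snoc-𝟙 x)) ⟩
  ∑[ x < suc d ] Σ-words (suc d) n (λ u → 𝟙 (h ≡ᵇ occ x u) * 𝟙 (complete (suc h) d (remove x u)))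
    ≡⟨ sum-cong-≗ {suc d} (λ x →
         Σ-words-occ-remove-* x (λ j → 𝟙 (h ≡ᵇ j)) (𝟙 ∘ complete (suc h) d) n) ⟩
  ∑[ x < suc d ] binomialSum n (λ j → 𝟙 (h ≡ᵇ j) * #complete (suc h) d (n ∸ j))
    ≡⟨ ∑-const (suc d) _ ⟩
  suc d * binomialSum n (λ j → 𝟙 (h ≡ᵇ j) * #complete (suc h) d (n ∸ j))
    ≡⟨ cong (suc d *_) (binomialSum-point n h (λ j → #complete (suc h) d (n ∸ j))) ⟩
  suc d * (𝟙 (h <ᵇ suc n) * ((n C h) * #complete (suc h) d (n ∸ h)))
    ∎
  where
  hitsAt-snoc-𝟙 : ∀ x u → length u ≡ n →
    𝟙 (hitsAt (suc h) (suc d) (suc n) (u ++ x ∷ []))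
      ≡ 𝟙 (h ≡ᵇ occ x u) * 𝟙 (complete (suc h) d (remove x u))
  hitsAt-snoc-𝟙 x u refl =
    trans (cong 𝟙 (hitsAt-snoc h x u)) (𝟙-∧ (h ≡ᵇ occ x u) (complete (suc h) d (remove x u)))

mainTheorem3 : (h d : ℕ) → h ≥ 1 → d ≥ 1 → (n : ℕ) →
    countT h d n ≡ (if h ≤ᵇ n then (d !) * ((n ∸ 1) C (h ∸ 1)) * S≥ h (n ∸ h) (d ∸ 1) else 0)
mainTheorem3 (suc h) (suc d) _ _ zero    = refl
mainTheorem3 (suc h) (suc d) _ _ (suc n) = begin
  countT (suc h) (suc d) (suc n)
    ≡⟨ countT-suc h d n ⟩
  suc d * (𝟙 (h <ᵇ suc n) * ((n C h) * #complete (suc h) d (n ∸ h)))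
    ≡⟨ cong (λ t → suc d * (𝟙 (h <ᵇ suc n) * ((n C h) * t))) (#complete≡!*#partitions h d (n ∸ h)) ⟩
  suc d * (𝟙 (h <ᵇ suc n) * ((n C h) * (d ! * #partitions (suc h) d (n ∸ h))))
    ≡⟨ cong (λ t → suc d * (𝟙 (h <ᵇ suc n) * ((n C h) * (d ! * t)))) (countᵇ-seqs d (n ∸ h) _) ⟨
  suc d * (𝟙 (h <ᵇ suc n) * ((n C h) * (d ! * S≥ (suc h) (n ∸ h) d)))
    ≡⟨ rearrange (h <ᵇ suc n) ⟩
  (if h <ᵇ suc n then suc d ! * (n C h) * S≥ (suc h) (n ∸ h) d else 0)
    ∎
  where
  rearrange : ∀ b → suc d * (𝟙 b * ((n C h) * (d ! * S≥ (suc h) (n ∸ h) d)))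
                    ≡ (if b then suc d ! * (n C h) * S≥ (suc h) (n ∸ h) d else 0)
  rearrange true  = solve 4 (λ D f c s → D :* ((c :* (f :* s)) :+ con 0) := (D :* f) :* c :* s) refl
                      (suc d) (d !) (n C h) (S≥ (suc h) (n ∸ h) d)
    where open +-*-Solver using (solve; con; _:+_; _:*_; _:=_)
  rearrange false = *-zeroʳ (suc d)
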